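{- Let $(L,G)$ be an instance of the bootstrap problem with $G=(V,E)$, and let $S\subseteq V$. Then $S$ is a feasible solution if and only if every directed path $v_1v_2\dots v_k$ in $G$ that starts at a red vertex, ends at a red vertex, and contains exactly $L+1$ red vertices (counting the endpoints) has some vertex among $v_1,\dots,v_{k-1}$ in $S$.
   Context: The bootstrap problem. The input is a positive integer $L$ and a directed acyclic graph $G=(V,E)$ (parallel edges allowed) in which every vertex has indegree $0$ or $2$; vertices of indegree $0$ are colored white and vertices of indegree $2$ are colored either blue or red. For a set $S\subseteq V$ of marked vertices, define $\ell:V\to\mathbb{Z}_{\geq 0}$ recursively (along a topological order) by: $\ell(v)=0$ if $v$ is white; $\ell(v)=\max_{(u,v)\in E}\ell(u)\cdot \mathbb{1}_{V\setminus S}(u)$ if $v$ is blue; $\ell(v)=\max_{(u,v)\in E}\ell(u)\cdot \mathbb{1}_{V\setminus S}(u)+1$ if $v$ is red, where $\mathbb{1}_{V\setminus S}$ equals $1$ on $V\setminus S$ and $0$ on $S$. The set $S$ is a feasible solution if $\max_{u\in V}\ell(u)\leq L$. -}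

module Defs where

open import Data.Nat using (ℕ; zero; suc; _≤_; _⊔_)
open import Data.Bool using (Bool; true; false; if_then_else_)
open import Data.Fin using (Fin)
open import Data.Fin.Properties using () renaming (_≟_ to _≟F_)
open import Data.Fin.Subset using (Subset; _∈_; _∉_)
open import Data.Fin.Subset.Properties using (_∈?_)
open import Data.List using (List; []; _∷_; _∷ʳ_; length; filter; filterᵇ; map; foldr)
open import Data.List.Membership.Propositional using () renaming (_∈_ to _∈ᴸ_)
open import Data.List.Relation.Unary.Linked using (Linked)
open import Data.List.Relation.Unary.Any using (Any)
open import Data.Product using (_×_; _,_; proj₁; proj₂)
open import Relation.Nullary using (¬_; does)
open import Relation.Binary.PropositionalEquality using (_≡_)

data Colour : Set where
  white blue red : Colour

isRed : Colour → Bool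
isRed red = true
isRed _   = false

-- A directed multigraph on vertex set Fin n: a list of edges (u , v),
-- meaning u → v (repetitions = parallel edges), with a colouring.
record Graph (n : ℕ) : Set where
  field
    edges  : List (Fin n × Fin n)
    colour : Fin n → Colour

  inEdges : Fin n → List (Fin n × Fin n)
  inEdges v = filter (λ e → proj₂ e ≟F v) edges

  indeg : Fin n → ℕ
  indeg v = length (inEdges v)

  Edge : Fin n → Fin n → Set
  Edge u v = (u , v) ∈ᴸ edges

  -- a directed walk/path given as the vertex sequence  ps ++ [ last ]
  -- (v₁ … v_k with v_k = last; ps = v₁ … v_{k-1} may be empty)
  IsPath : List (Fin n) → Fin n → Set
  IsPath ps last = Linked Edge (ps ∷ʳ last)

  Acyclic : Set
  Acyclic = ∀ (v : Fin n) (ps : List (Fin n)) → ¬ IsPath (v ∷ ps) v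

-- (L , G) is an instance of the bootstrap problem (L positive is stated separately)
record IsBootstrapGraph {n : ℕ} (G : Graph n) : Set where
  open Graph G
  field
    acyclic   : Acyclic
    white⇒in0 : ∀ v → colour v ≡ white → indeg v ≡ 0
    blue⇒in2  : ∀ v → colour v ≡ blue → indeg v ≡ 2
    red⇒in2   : ∀ v → colour v ≡ red → indeg v ≡ 2

firstOf : {n : ℕ} → List (Fin n) → Fin n → Fin n
firstOf []      last = last
firstOf (p ∷ _) last = p

module _ {n : ℕ} (G : Graph n) (S : Subset n) where
  open Graph G

  masked : (Fin n → ℕ) → Fin n → ℕ
  masked ℓ u = if does (u ∈? S) then 0 else ℓ u

  inMax : (Fin n → ℕ) → Fin n → ℕ
  inMax ℓ v = foldr _⊔_ 0 (map (λ e → masked ℓ (proj₁ e)) (inEdges v))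

  -- ℓ satisfies the defining recursion of the level function
  -- (on a DAG there is exactly one such ℓ)
  IsLevel : (Fin n → ℕ) → Set
  IsLevel ℓ = ∀ v →
    (colour v ≡ white → ℓ v ≡ 0) ×
    (colour v ≡ blue  → ℓ v ≡ inMax ℓ v) ×
    (colour v ≡ red   → ℓ v ≡ suc (inMax ℓ v))

Feasible : {n : ℕ} → ℕ → Graph n → Subset n → Set
Feasible L G S = ∀ ℓ → IsLevel G S ℓ → ∀ v → ℓ v ≤ L

PathCondition : {n : ℕ} → ℕ → Graph n → Subset n → Set
PathCondition {n} L G S =
  ∀ (ps : List (Fin n)) (last : Fin n) →
  Graph.IsPath G ps last →
  Graph.colour G (firstOf ps last) ≡ red →
  Graph.colour G last ≡ red →
  length (filterᵇ (λ v → isRed (Graph.colour G v)) (ps ∷ʳ last)) ≡ suc L →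
  Any (_∈ S) ps

-- Along an edge u → v with u ∉ S the level of v is at least that of u, and
-- strictly larger if v is red.  Summing this along a walk whose vertices
-- other than the last avoid S shows that the last vertex has level at least
-- the number of red vertices on the walk; a feasible S therefore meets every
-- walk with L + 1 red vertices.  Conversely, from a vertex of level > L one
-- can repeatedly step back to a predecessor outside S realising the maximum
-- in the recursion: this first reaches a red vertex of level exactly L + 1,
-- and continuing down to a red vertex of level 1 traces a red-to-red walk
-- with L + 1 red vertices avoiding S before its end.  As feasibility speaks
-- about every solution of the recursion, the forward direction also needs
-- one to exist: on an acyclic graph with n vertices, n iterations of the
-- recursion from the zero function already reach a fixed point.
module Submission where

open import Defs
open import Data.Nat using (ℕ; _≤_)
open import Data.Fin.Subset using (Subset)
open import Function.Bundles using (_⇔_; mk⇔)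

open import Data.Nat using (zero; suc; _+_; _⊔_; _<_; z≤n; s≤s)
open import Data.Nat.Properties
open import Algebra.Properties.CommutativeSemigroup +-commutativeSemigroup using (x∙yz≈y∙xz)
open import Data.Bool using (if_then_else_)
open import Data.Fin using (Fin; zero; suc)
import Data.Fin as Fin
open import Data.Fin.Properties using (pigeonhole) renaming (_≟_ to _≟F_)
open import Data.Fin.Subset using (_∉_)
open import Data.Fin.Subset.Properties using (_∈?_)
open import Data.List using (List; []; _∷_; _∷ʳ_; length; lookup; filterᵇ; map; foldr)
open import Data.List.Membership.Propositional using () renaming (_∈_ to _∈ᴸ_)
open import Data.List.Membership.Propositional.Properties using (∈-filter⁺; ∈-filter⁻; ∈-map⁺; ∈-map⁻; foldr-selective)
open import Data.List.Relation.Unary.Any using (here; there; any?)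
open import Data.List.Relation.Unary.All using (All; []; _∷_; tabulate)
open import Data.List.Relation.Unary.All.Properties using (∷ʳ⁺; ¬Any⇒All¬; All¬⇒¬Any)
open import Data.List.Relation.Unary.Linked using (Linked; []; [-]; _∷_)
open import Data.List.Properties using (map-cong-local)
open import Data.Product using (Σ; ∃; _×_; _,_; proj₁; proj₂)
open import Data.Sum using (inj₁; inj₂)
import Function.Endo.Propositional as Endo
open import Induction.WellFounded using (Acc; acc)
open import Relation.Binary.Core using (Rel)
open import Relation.Nullary using (does; yes; no; contradiction)
open import Relation.Nullary.Decidable using (decidable-stable)
open import Relation.Binary.PropositionalEquality

redWeight : Colour → ℕ
redWeight red   = 1
redWeight white = 0
redWeight blue  = 0

levelOf : Colour → ℕ → ℕ
levelOf white _ = 0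
levelOf blue  m = m
levelOf red   m = suc m

≤-foldr-⊔ : ∀ {x xs} → x ∈ᴸ xs → x ≤ foldr _⊔_ 0 xs
≤-foldr-⊔ (here refl)  = m≤m⊔n _ _
≤-foldr-⊔ (there x∈xs) = ≤-trans (≤-foldr-⊔ x∈xs) (m≤n⊔m _ _)

module _ {a r} {A : Set a} {R : Rel A r} where

  linked-∷ʳ⁺ : ∀ xs {u v} → Linked R (xs ∷ʳ u) → R u v → Linked R (xs ∷ʳ u ∷ʳ v)
  linked-∷ʳ⁺ []           [-]        r = r ∷ [-]
  linked-∷ʳ⁺ (_ ∷ [])     (r′ ∷ [-]) r = r′ ∷ r ∷ [-]
  linked-∷ʳ⁺ (_ ∷ y ∷ xs) (r′ ∷ rs)  r = r′ ∷ linked-∷ʳ⁺ (y ∷ xs) rs r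

  linked-segment : ∀ {xs} → Linked R xs → (i j : Fin (length xs)) → i Fin.< j →
                   Σ (List A) λ ps → Linked R (lookup xs i ∷ ps ∷ʳ lookup xs j)
  linked-segment (r ∷ _)  zero    (suc zero)    _ = [] , r ∷ [-]
  linked-segment (r ∷ rs) zero    (suc (suc j)) _ with ps , seg ← linked-segment rs zero (suc j) (s≤s z≤n)
    = _ ∷ ps , r ∷ seg
  linked-segment (_ ∷ rs) (suc i) (suc j) (s≤s i<j) = linked-segment rs i j i<j

firstOf-∷ʳ : ∀ {n} (ps : List (Fin n)) u v → firstOf (ps ∷ʳ u) v ≡ firstOf ps u
firstOf-∷ʳ []      _ _ = refl
firstOf-∷ʳ (_ ∷ _) _ _ = refl

module AcyclicGraph {n : ℕ} (G : Graph n) (acyclic : Graph.Acyclic G) where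
  open Graph G

  walk-length≤n : ∀ {xs} → Linked Edge xs → length xs ≤ n
  walk-length≤n {xs} walk = decidable-stable (length xs ≤? n) λ long →
    let i , j , i<j , xsᵢ≡xsⱼ = pigeonhole (≰⇒> long) (lookup xs)
        ps , cycle = linked-segment walk i j i<j
    in acyclic _ ps (subst (IsPath (lookup xs i ∷ ps)) (sym xsᵢ≡xsⱼ) cycle)

  -- Descending k times from v traces a walk of k + 1 vertices ending at v;
  -- as walks have at most n vertices, P 0 is never demanded.
  height-induction : (P : ℕ → Fin n → Set) →
                     (∀ {k v} → (∀ {u} → Edge u v → P k u) → P (suc k) v) →
                     ∀ v → P n v
  height-induction P step v = go n v [] [-] (+-identityʳ n)
    where
      go : ∀ k v xs → Linked Edge (v ∷ xs) → k + length xs ≡ n → P k v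
      go zero    v xs walk len = contradiction (subst (λ m → suc m ≤ n) len (walk-length≤n walk)) (n≮n n)
      go (suc k) v xs walk len = step λ e → go k _ (v ∷ xs) (e ∷ walk) (trans (+-suc k _) len)

  edge-wellFounded : ∀ v → Acc Edge v
  edge-wellFounded = height-induction (λ _ → Acc Edge) acc

  module _ {A : Set} where
    open Endo (Fin n → A) using (_^_)

    iterate-fixedPoint : (F : (Fin n → A) → Fin n → A) →
                         (∀ {f g} v → (∀ {u} → Edge u v → f u ≡ g u) → F f v ≡ F g v) →
                         ∀ f v → (F ^ n) f v ≡ F ((F ^ n) f) v
    iterate-fixedPoint F local f v = height-induction Stable stable v n ≤-refl
      where
        Stable : ℕ → Fin n → Set
        Stable k v = ∀ j → k ≤ j → (F ^ j) f v ≡ (F ^ suc j) f v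

        stable : ∀ {k v} → (∀ {u} → Edge u v → Stable k u) → Stable (suc k) v
        stable {v = v} ih (suc j) (s≤s k≤j) = local v λ e → ih e j k≤j

module GraphProperties {n : ℕ} (G : Graph n) where
  open Graph G

  redCount : List (Fin n) → ℕ
  redCount xs = length (filterᵇ (λ v → isRed (colour v)) xs)

  redCount-∷ : ∀ x xs → redCount (x ∷ xs) ≡ redWeight (colour x) + redCount xs
  redCount-∷ x xs with colour x
  ... | white = refl
  ... | blue  = refl
  ... | red   = refl

  redCount-∷ʳ : ∀ xs v → redCount (xs ∷ʳ v) ≡ redWeight (colour v) + redCount xs
  redCount-∷ʳ []       v = redCount-∷ v []
  redCount-∷ʳ (x ∷ xs) v = begin
    redCount (x ∷ xs ∷ʳ v)                                      ≡⟨ redCount-∷ x (xs ∷ʳ v) ⟩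
    redWeight (colour x) + redCount (xs ∷ʳ v)                   ≡⟨ cong (redWeight (colour x) +_) (redCount-∷ʳ xs v) ⟩
    redWeight (colour x) + (redWeight (colour v) + redCount xs) ≡⟨ x∙yz≈y∙xz (redWeight (colour x)) (redWeight (colour v)) _ ⟩
    redWeight (colour v) + (redWeight (colour x) + redCount xs) ≡⟨ cong (redWeight (colour v) +_) (redCount-∷ x xs) ⟨
    redWeight (colour v) + redCount (x ∷ xs)                    ∎
    where open ≡-Reasoning

  redCount-[_] : ∀ v → redCount (v ∷ []) ≡ redWeight (colour v)
  redCount-[ v ] = trans (redCount-∷ v []) (+-identityʳ _)

  ∈-inEdges⁻ : ∀ {e v} → e ∈ᴸ inEdges v → Edge (proj₁ e) v
  ∈-inEdges⁻ {v = v} e∈ with ∈-filter⁻ (λ e → proj₂ e ≟F v) {xs = edges} e∈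
  ... | e∈edges , refl = e∈edges

  ∈-inEdges⁺ : ∀ {u v} → Edge u v → (u , v) ∈ᴸ inEdges v
  ∈-inEdges⁺ {v = v} e = ∈-filter⁺ (λ e → proj₂ e ≟F v) e refl

  inEdge⇒indeg≢0 : ∀ {u v} → Edge u v → indeg v ≢ 0
  inEdge⇒indeg≢0 {v = v} e with inEdges v | ∈-inEdges⁺ e
  ... | _ ∷ _ | _ = λ ()

module Levels {n : ℕ} (G : Graph n) (S : Subset n) where
  open Graph G
  open GraphProperties G

  levelStep : (Fin n → ℕ) → Fin n → ℕ
  levelStep ℓ v = levelOf (colour v) (inMax G S ℓ v)

  isLevel⇒fixedPoint : ∀ {ℓ} → IsLevel G S ℓ → ∀ v → ℓ v ≡ levelStep ℓ v
  isLevel⇒fixedPoint level v with colour v in c≡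
  ... | white = proj₁ (level v) c≡
  ... | blue  = proj₁ (proj₂ (level v)) c≡
  ... | red   = proj₂ (proj₂ (level v)) c≡

  fixedPoint⇒isLevel : ∀ {ℓ} → (∀ v → ℓ v ≡ levelStep ℓ v) → IsLevel G S ℓ
  fixedPoint⇒isLevel {ℓ} fixed v = at , at , at
    where
      at : ∀ {c} → colour v ≡ c → ℓ v ≡ levelOf c (inMax G S ℓ v)
      at refl = fixed v

  inMax-local : ∀ {ℓ ℓ′} v → (∀ {u} → Edge u v → ℓ u ≡ ℓ′ u) → inMax G S ℓ v ≡ inMax G S ℓ′ v
  inMax-local {ℓ} {ℓ′} v agree = cong (foldr _⊔_ 0) (map-cong-local (tabulate λ {e} e∈ →
    cong (λ k → if does (proj₁ e ∈? S) then 0 else k) (agree (∈-inEdges⁻ e∈))))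

  level-exists : Acyclic → Σ (Fin n → ℕ) (IsLevel G S)
  level-exists acyclic = ℓ , fixedPoint⇒isLevel (iterate-fixedPoint levelStep levelStep-local (λ _ → 0))
    where
      open AcyclicGraph G acyclic
      open Endo (Fin n → ℕ) using (_^_)

      ℓ : Fin n → ℕ
      ℓ = (levelStep ^ n) (λ _ → 0)

      levelStep-local : ∀ {ℓ ℓ′} v → (∀ {u} → Edge u v → ℓ u ≡ ℓ′ u) → levelStep ℓ v ≡ levelStep ℓ′ v
      levelStep-local v agree = cong (levelOf (colour v)) (inMax-local v agree)

  record RedWalk (v : Fin n) (m : ℕ) : Set where
    field
      init      : List (Fin n)
      isPath    : IsPath init v
      startsRed : colour (firstOf init v) ≡ red
      avoidsS   : All (_∉ S) init
      reds      : redCount (init ∷ʳ v) ≡ m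

  redWalk-[_] : ∀ v → colour v ≡ red → RedWalk v 1
  redWalk-[ v ] v-red = record
    { init = [] ; isPath = [-] ; startsRed = v-red ; avoidsS = []
    ; reds = trans redCount-[ v ] (cong redWeight v-red) }

  redWalk-∷ʳ : ∀ {u v m} → RedWalk u m → u ∉ S → Edge u v → RedWalk v (redWeight (colour v) + m)
  redWalk-∷ʳ {u} {v} walk u∉S e = record
    { init      = init ∷ʳ u
    ; isPath    = linked-∷ʳ⁺ init isPath e
    ; startsRed = trans (cong colour (firstOf-∷ʳ init u v)) startsRed
    ; avoidsS   = ∷ʳ⁺ avoidsS u∉S
    ; reds      = trans (redCount-∷ʳ (init ∷ʳ u) v) (cong (redWeight (colour v) +_) reds) }
    where open RedWalk walk

module LevelProperties {n : ℕ} {G : Graph n} (bootstrap : IsBootstrapGraph G) (S : Subset n)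
                       (ℓ : Fin n → ℕ) (level : IsLevel G S ℓ) where
  open Graph G
  open IsBootstrapGraph bootstrap
  open GraphProperties G
  open Levels G S

  M : Fin n → ℕ
  M = inMax G S ℓ

  maskedSource : Fin n × Fin n → ℕ
  maskedSource e = masked G S ℓ (proj₁ e)

  level≡ : ∀ v → ℓ v ≡ levelOf (colour v) (M v)
  level≡ = isLevel⇒fixedPoint level

  masked-∉ : ∀ {u} → u ∉ S → masked G S ℓ u ≡ ℓ u
  masked-∉ {u} u∉S with u ∈? S
  ... | yes u∈S = contradiction u∈S u∉S
  ... | no  _   = refl

  ≤-inMax : ∀ {u v} → Edge u v → u ∉ S → ℓ u ≤ M v
  ≤-inMax e u∉S = subst (_≤ _) (masked-∉ u∉S) (≤-foldr-⊔ (∈-map⁺ maskedSource (∈-inEdges⁺ e)))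

  maxPredecessor : ∀ v → 1 ≤ M v → ∃ λ u → Edge u v × u ∉ S × ℓ u ≡ M v
  maxPredecessor v pos with foldr-selective ⊔-sel 0 (map maskedSource (inEdges v))
  ... | inj₁ M≡0 = contradiction (subst (1 ≤_) M≡0 pos) λ ()
  ... | inj₂ M∈ with ∈-map⁻ maskedSource M∈
  ... | (u , _) , e∈ , M≡masked with u ∈? S
  ...   | yes _   = contradiction (subst (1 ≤_) M≡masked pos) λ ()
  ...   | no  u∉S = u , ∈-inEdges⁻ e∈ , u∉S , sym M≡masked

  redWeight≤level : ∀ v → redWeight (colour v) ≤ ℓ v
  redWeight≤level v rewrite level≡ v with colour v
  ... | white = z≤n
  ... | blue  = z≤n
  ... | red   = s≤s z≤n

  redWeight+level≤level : ∀ {u v} → Edge u v → u ∉ S → redWeight (colour v) + ℓ u ≤ ℓ v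
  redWeight+level≤level {v = v} e u∉S rewrite level≡ v with colour v in c≡
  ... | white = contradiction (white⇒in0 v c≡) (inEdge⇒indeg≢0 e)
  ... | blue  = ≤-inMax e u∉S
  ... | red   = s≤s (≤-inMax e u∉S)

  level≤1+inMax : ∀ v → ℓ v ≤ suc (M v)
  level≤1+inMax v rewrite level≡ v with colour v
  ... | white = z≤n
  ... | blue  = n≤1+n _
  ... | red   = ≤-refl

  positive-level : ∀ {v} → 1 ≤ ℓ v → ℓ v ≡ redWeight (colour v) + M v
  positive-level {v} pos rewrite level≡ v with colour v
  ... | blue = refl
  ... | red  = refl

  inMax<level⇒red : ∀ {v} → M v < ℓ v → colour v ≡ red
  inMax<level⇒red {v} M<ℓ rewrite level≡ v with colour v
  ... | blue = contradiction M<ℓ (n≮n _)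
  ... | red  = refl

  redCount-tail+level≤level : ∀ x ps last → IsPath (x ∷ ps) last → All (_∉ S) (x ∷ ps) →
                              redCount (ps ∷ʳ last) + ℓ x ≤ ℓ last
  redCount-tail+level≤level x [] last (e ∷ [-]) (x∉S ∷ []) = begin
    redCount (last ∷ []) + ℓ x    ≡⟨ cong (_+ ℓ x) redCount-[ last ] ⟩
    redWeight (colour last) + ℓ x ≤⟨ redWeight+level≤level e x∉S ⟩
    ℓ last                        ∎
    where open ≤-Reasoning
  redCount-tail+level≤level x (y ∷ ps) last (e ∷ walk) (x∉S ∷ avoids) = begin
    redCount (y ∷ ps ∷ʳ last) + ℓ x                         ≡⟨ cong (_+ ℓ x) (redCount-∷ y (ps ∷ʳ last)) ⟩
    (redWeight (colour y) + redCount (ps ∷ʳ last)) + ℓ x    ≡⟨ +-assoc (redWeight (colour y)) _ _ ⟩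
    redWeight (colour y) + (redCount (ps ∷ʳ last) + ℓ x)    ≡⟨ x∙yz≈y∙xz (redWeight (colour y)) (redCount (ps ∷ʳ last)) (ℓ x) ⟩
    redCount (ps ∷ʳ last) + (redWeight (colour y) + ℓ x)    ≤⟨ +-monoʳ-≤ (redCount (ps ∷ʳ last)) (redWeight+level≤level e x∉S) ⟩
    redCount (ps ∷ʳ last) + ℓ y                             ≤⟨ redCount-tail+level≤level y ps last walk avoids ⟩
    ℓ last                                                  ∎
    where open ≤-Reasoning

  redCount≤level : ∀ ps last → IsPath ps last → All (_∉ S) ps → redCount (ps ∷ʳ last) ≤ ℓ last
  redCount≤level [] last _ [] = ≤-trans (≤-reflexive redCount-[ last ]) (redWeight≤level last)
  redCount≤level (x ∷ ps) last walk avoids = begin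
    redCount (x ∷ ps ∷ʳ last)                       ≡⟨ redCount-∷ x (ps ∷ʳ last) ⟩
    redWeight (colour x) + redCount (ps ∷ʳ last)    ≡⟨ +-comm (redWeight (colour x)) _ ⟩
    redCount (ps ∷ʳ last) + redWeight (colour x)    ≤⟨ +-monoʳ-≤ (redCount (ps ∷ʳ last)) (redWeight≤level x) ⟩
    redCount (ps ∷ʳ last) + ℓ x                     ≤⟨ redCount-tail+level≤level x ps last walk avoids ⟩
    ℓ last                                          ∎
    where open ≤-Reasoning

  redWalkToLevel : ∀ v → Acc Edge v → 1 ≤ ℓ v → RedWalk v (ℓ v)
  redWalkToLevel v (acc rs) pos with 1 ≤? M v
  ... | yes M-pos =
    let u , e , u∉S , ℓu≡M = maxPredecessor v M-pos
        walk = redWalk-∷ʳ (redWalkToLevel u (rs e) (subst (1 ≤_) (sym ℓu≡M) M-pos)) u∉S e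
    in subst (RedWalk v) (trans (cong (redWeight (colour v) +_) ℓu≡M) (sym (positive-level pos))) walk
  ... | no M≯0 = subst (RedWalk v) (≤-antisym pos ℓ≤1) (redWalk-[ v ] (inMax<level⇒red (<-≤-trans M<1 pos)))
    where
      M<1 : M v < 1
      M<1 = ≰⇒> M≯0

      ℓ≤1 : ℓ v ≤ 1
      ℓ≤1 = ≤-trans (level≤1+inMax v) M<1

  redWalkWithReds : ∀ v → Acc Edge v → ∀ m → 1 ≤ m → m ≤ ℓ v → ∃ λ w → colour w ≡ red × RedWalk w m
  redWalkWithReds v (acc rs) m pos m≤ℓ with m ≤? M v
  ... | yes m≤M =
    let u , e , _ , ℓu≡M = maxPredecessor v (≤-trans pos m≤M)
    in redWalkWithReds u (rs e) m pos (subst (m ≤_) (sym ℓu≡M) m≤M)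
  ... | no m≰M =
    v , inMax<level⇒red (<-≤-trans M<m m≤ℓ) , subst (RedWalk v) ℓ≡m (redWalkToLevel v (acc rs) (≤-trans pos m≤ℓ))
    where
      M<m : M v < m
      M<m = ≰⇒> m≰M

      ℓ≡m : ℓ v ≡ m
      ℓ≡m = ≤-antisym (≤-trans (level≤1+inMax v) M<m) m≤ℓ

module _ {n : ℕ} (L : ℕ) {G : Graph n} (bootstrap : IsBootstrapGraph G) (S : Subset n) where
  open IsBootstrapGraph bootstrap
  open Levels G S
  open RedWalk

  feasible⇒pathCondition : Feasible L G S → PathCondition L G S
  feasible⇒pathCondition feasible ps last isPath _ _ reds =
    decidable-stable (any? (_∈? S) ps) λ ¬hitsS →
      n≮n L (≤-trans (subst (_≤ ℓ last) reds (redCount≤level ps last isPath (¬Any⇒All¬ ps ¬hitsS)))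
                     (feasible ℓ level last))
    where
      ℓ : Fin n → ℕ
      ℓ = proj₁ (level-exists acyclic)

      level : IsLevel G S ℓ
      level = proj₂ (level-exists acyclic)

      open LevelProperties bootstrap S ℓ level

  pathCondition⇒feasible : PathCondition L G S → Feasible L G S
  pathCondition⇒feasible pathCondition ℓ level v = decidable-stable (ℓ v ≤? L) λ ℓ≰L →
    let w , w-red , walk = redWalkWithReds v (edge-wellFounded v) (suc L) (s≤s z≤n) (≰⇒> ℓ≰L)
    in All¬⇒¬Any (avoidsS walk) (pathCondition (init walk) w (isPath walk) (startsRed walk) w-red (reds walk))
    where
      open AcyclicGraph G acyclic
      open LevelProperties bootstrap S ℓ level

fact1 : ∀ {n : ℕ} (L : ℕ) → 1 ≤ L → (G : Graph n) → IsBootstrapGraph G →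
    (S : Subset n) → Feasible L G S ⇔ PathCondition L G S
fact1 L _ G bootstrap S = mk⇔ (feasible⇒pathCondition L bootstrap S) (pathCondition⇒feasible L bootstrap S)
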